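{- Let $a>b\ge0$ be integers and $S=\{x+yi\in\mathbb{Z}[i]: 0\le x,y<a\}$. If $M\subseteq\mathbb{Z}[i]$ is closed under multiplication by units $\{\pm1,\pm i\}$ and $S\subseteq U=\bigcup_{q\in\mathbb{Z}[i]}(M+q(a+bi))$, then $M\twoheadrightarrow\mathbb{Z}[i]/(a+bi)$.
   Context: For $M\subseteq\mathbb{Z}[i]$ and $\beta\in\mathbb{Z}[i]$, $M\twoheadrightarrow\mathbb{Z}[i]/\beta$ means every residue class of $\mathbb{Z}[i]/(\beta)$ has a representative in $M$. -}

module Defs where

open import Level using (Level)
open import Data.Integer using (ℤ; _+_; _*_; _-_; -_; _≤_; _<_; +_; 0ℤ; 1ℤ)
open import Data.Product using (_×_; _,_; Σ; ∃-syntax)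
open import Relation.Binary.PropositionalEquality using (_≡_)

-- Gaussian integers ℤ[i], represented as pairs (x , y) meaning x + y i.
ℤ[i] : Set
ℤ[i] = ℤ × ℤ

_+ᵢ_ : ℤ → ℤ → ℤ[i]
x +ᵢ y = x , y

_⊕_ : ℤ[i] → ℤ[i] → ℤ[i]
(a , b) ⊕ (c , d) = (a + c , b + d)

_⊗_ : ℤ[i] → ℤ[i] → ℤ[i]
(a , b) ⊗ (c , d) = (a * c - b * d , a * d + b * c)

oneᵢ minusOneᵢ iᵢ minusIᵢ : ℤ[i]
oneᵢ = (1ℤ , 0ℤ)
minusOneᵢ = (- 1ℤ , 0ℤ)
iᵢ = (0ℤ , 1ℤ)
minusIᵢ = (0ℤ , - 1ℤ)

Subset : Set₁
Subset = ℤ[i] → Set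

UnitClosed : Subset → Set
UnitClosed M = ∀ z → M z →
  M (oneᵢ ⊗ z) × M (minusOneᵢ ⊗ z) × M (iᵢ ⊗ z) × M (minusIᵢ ⊗ z)

Translates : Subset → ℤ[i] → Subset
Translates M β z = ∃[ m ] ∃[ q ] (M m × z ≡ m ⊕ (q ⊗ β))

Box : ℤ → Subset
Box a (x , y) = (0ℤ ≤ x × x < a) × (0ℤ ≤ y × y < a)

Surjects : Subset → ℤ[i] → Set
Surjects M β = ∀ z → ∃[ m ] (M m × ∃[ q ] (z ≡ m ⊕ (q ⊗ β)))

-- The Gaussian integers form a Euclidean domain in which remainders can be chosen with
-- N(r) ≤ N(β)/2: rounding both coordinates of z·conj(β) to the nearest multiples of N(β)
-- gives a quotient q for which r = z − qβ satisfies N(r)·N(β) = N(r·conj β) ≤ N(β)²/2.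
-- For β = a + bi with 0 ≤ b < a we get N(r) ≤ (a² + b²)/2 < a², so r lies in the open
-- square (−a, a)², which is the union of the four rotations u·S of S by the units u.
-- Writing r = u·s with s ∈ S, the hypothesis gives m ∈ M with s ≡ m (mod β), and then
-- u·m ∈ M represents the class of z.
module Submission where

open import Defs
open import Data.Integer
  using (ℤ; +_; -[1+_]; _+_; _*_; _-_; -_; _≤_; _<_; 0ℤ; 1ℤ; +≤+; +<+
        ; NonZero; >-nonZero; positive; nonNegative)
open import Data.Integer.DivMod using (_/_; _%_; a≡a%n+[a/n]*n; n%d<d)
open import Data.Integer.Properties
  using ( ≤-refl; ≤-trans; ≤-<-trans; <⇒≤; <⇒≱; ≰⇒>; _≤?_; module ≤-Reasoning
        ; +-mono-≤; +-mono-<; +-mono-<-≤; +-monoˡ-≤; +-monoˡ-<; +-monoʳ-<; i≤i+j; i≤j+i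
        ; i≤j⇒0≤j-i; 0≤i-j⇒j≤i; 0≤i⇒+∣i∣≡i; neg-involutive; neg-mono-≤; neg-mono-<
        ; *-zeroʳ; *-monoˡ-≤-nonNeg; *-monoʳ-≤-nonNeg; *-monoʳ-<-pos; *-cancelˡ-≤-pos )
open import Data.Integer.Tactic.RingSolver using (solve-∀; solve)
open import Data.List using (_∷_; [])
open import Data.Nat using (z≤n)
open import Data.Product using (_×_; _,_; proj₁; proj₂; ∃-syntax)
open import Relation.Nullary using (¬_; yes; no)
open import Relation.Binary.PropositionalEquality
  using (_≡_; refl; sym; trans; cong; cong₂; subst; module ≡-Reasoning)

-- |2e| ≤ n: e is a residue of least absolute value modulo n.
Centred : ℤ → ℤ → Set
Centred n e = - n ≤ e + e × e + e ≤ n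

residue⇒centred : ∀ {m n k ρ} → m + m + n ≡ ρ + k * (n + n) → 0ℤ ≤ ρ → ρ < n + n →
                  Centred n (m - k * n)
residue⇒centred {m} {n} {k} {ρ} division 0≤ρ ρ<2n = lower , upper
  where
  twice-residue : (m - k * n) + (m - k * n) ≡ ρ - n
  twice-residue = begin
    (m - k * n) + (m - k * n)         ≡⟨ solve (m ∷ n ∷ k ∷ []) ⟩
    m + m + n - k * (n + n) - n       ≡⟨ cong (λ t → t - k * (n + n) - n) division ⟩
    ρ + k * (n + n) - k * (n + n) - n ≡⟨ solve (ρ ∷ n ∷ k ∷ []) ⟩
    ρ - n                             ∎
    where open ≡-Reasoning
  open ≤-Reasoning
  lower : - n ≤ (m - k * n) + (m - k * n)
  lower = begin
    - n                       ≡⟨ solve (n ∷ []) ⟩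
    0ℤ - n                    ≤⟨ +-monoˡ-≤ (- n) 0≤ρ ⟩
    ρ - n                     ≡⟨ twice-residue ⟨
    (m - k * n) + (m - k * n) ∎
  upper : (m - k * n) + (m - k * n) ≤ n
  upper = begin
    (m - k * n) + (m - k * n) ≡⟨ twice-residue ⟩
    ρ - n                     <⟨ +-monoˡ-< (- n) ρ<2n ⟩
    n + n - n                 ≡⟨ solve (n ∷ []) ⟩
    n                         ∎

-- k is m/n rounded to the nearest integer, obtained by dividing 2m + n by 2n.
centred-residue : ∀ m n → 0ℤ < n → ∃[ k ] Centred n (m - k * n)
centred-residue m n 0<n =
  k , residue⇒centred {m} {n} {k} (a≡a%n+[a/n]*n (m + m + n) (n + n)) (+≤+ z≤n) residue<2n
  where
  0<2n : 0ℤ < n + n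
  0<2n = +-mono-< 0<n 0<n
  instance
    2n≢0 : NonZero (n + n)
    2n≢0 = >-nonZero 0<2n
  k : ℤ
  k = (m + m + n) / (n + n)
  residue<2n : + ((m + m + n) % (n + n)) < n + n
  residue<2n = subst (+ ((m + m + n) % (n + n)) <_) (0≤i⇒+∣i∣≡i (<⇒≤ 0<2n))
                     (+<+ (n%d<d (m + m + n) (n + n)))

*-nonNeg : ∀ {i j} → 0ℤ ≤ i → 0ℤ ≤ j → 0ℤ ≤ i * j
*-nonNeg {i} {j} 0≤i 0≤j =
  subst (_≤ i * j) (*-zeroʳ i) (*-monoˡ-≤-nonNeg i ⦃ nonNegative 0≤i ⦄ 0≤j)

centred-sum-of-squares : ∀ {n e₁ e₂ N} → 0ℤ < n → Centred n e₁ → Centred n e₂ →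
                         e₁ * e₁ + e₂ * e₂ ≡ N * n → N + N ≤ n
centred-sum-of-squares {n} {e₁} {e₂} {N} 0<n (l₁ , u₁) (l₂ , u₂) sum≡ =
  0≤i-j⇒j≤i (*-cancelˡ-≤-pos 0ℤ (n - (N + N)) (n + n) ⦃ positive (+-mono-< 0<n 0<n) ⦄
                             0≤2n[n-2N])
  where
  open ≤-Reasoning
  0≤2n[n-2N] : (n + n) * 0ℤ ≤ (n + n) * (n - (N + N))
  0≤2n[n-2N] = begin
    (n + n) * 0ℤ
      ≡⟨ *-zeroʳ (n + n) ⟩
    0ℤ
      ≤⟨ +-mono-≤ (*-nonNeg (i≤j⇒0≤j-i u₁) (i≤j⇒0≤j-i l₁))
                  (*-nonNeg (i≤j⇒0≤j-i u₂) (i≤j⇒0≤j-i l₂)) ⟩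
    (n - (e₁ + e₁)) * ((e₁ + e₁) - - n) + (n - (e₂ + e₂)) * ((e₂ + e₂) - - n)
      ≡⟨ solve (n ∷ e₁ ∷ e₂ ∷ []) ⟩
    (n + n) * n - ((e₁ * e₁ + e₂ * e₂ + (e₁ * e₁ + e₂ * e₂))
                   + (e₁ * e₁ + e₂ * e₂ + (e₁ * e₁ + e₂ * e₂)))
      ≡⟨ cong (λ s → (n + n) * n - ((s + s) + (s + s))) sum≡ ⟩
    (n + n) * n - ((N * n + N * n) + (N * n + N * n))
      ≡⟨ solve (n ∷ N ∷ []) ⟩
    (n + n) * (n - (N + N))
      ∎

square-nonNeg : ∀ x → 0ℤ ≤ x * x
square-nonNeg (+ n)    = *-nonNeg {+ n} {+ n} (+≤+ z≤n) (+≤+ z≤n)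
square-nonNeg -[1+ n ] = +≤+ z≤n

square-mono-≤ : ∀ {i j} → 0ℤ ≤ i → i ≤ j → i * i ≤ j * j
square-mono-≤ {i} {j} 0≤i i≤j =
  ≤-trans (*-monoˡ-≤-nonNeg i ⦃ nonNegative 0≤i ⦄ i≤j)
          (*-monoʳ-≤-nonNeg j ⦃ nonNegative (≤-trans 0≤i i≤j) ⦄ i≤j)

square-mono-< : ∀ {i j} → 0ℤ ≤ i → i < j → i * i < j * j
square-mono-< {i} {j} 0≤i i<j =
  ≤-<-trans (*-monoˡ-≤-nonNeg i ⦃ nonNegative 0≤i ⦄ (<⇒≤ i<j))
            (*-monoʳ-<-pos j ⦃ positive (≤-<-trans 0≤i i<j) ⦄ i<j)

square-<⇒bounded : ∀ {a x} → 0ℤ ≤ a → x * x < a * a → - a < x × x < a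
square-<⇒bounded {a} {x} 0≤a x²<a² =
  ≰⇒> (λ x≤-a → <⇒≱ x²<a² (subst (a * a ≤_) (neg-square x)
                                   (square-mono-≤ 0≤a (a≤-x x≤-a)))) ,
  ≰⇒> (λ a≤x → <⇒≱ x²<a² (square-mono-≤ 0≤a a≤x))
  where
  neg-square : ∀ x → - x * - x ≡ x * x
  neg-square = solve-∀
  a≤-x : x ≤ - a → a ≤ - x
  a≤-x x≤-a = subst (_≤ - x) (neg-involutive a) (neg-mono-≤ x≤-a)

double-<⇒< : ∀ {i j} → i + i < j + j → i < j
double-<⇒< 2i<2j = ≰⇒> (λ j≤i → <⇒≱ 2i<2j (+-mono-≤ j≤i j≤i))

conj : ℤ[i] → ℤ[i]
conj (x , y) = x , - y

infix 25 -ᵢ_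
-ᵢ_ : ℤ[i] → ℤ[i]
-ᵢ (x , y) = - x , - y

norm : ℤ[i] → ℤ
norm (x , y) = x * x + y * y

norm-⊗-conj : ∀ z w → norm (z ⊗ conj w) ≡ norm z * norm w
norm-⊗-conj (x , y) (a , b) = brahmagupta-fibonacci
  where
  brahmagupta-fibonacci : (x * a - y * - b) * (x * a - y * - b) + (x * - b + y * a) * (x * - b + y * a)
                        ≡ (x * x + y * y) * (a * a + b * b)
  brahmagupta-fibonacci = solve (x ∷ y ∷ a ∷ b ∷ [])

0<a⇒0<norm : ∀ {a b} → 0ℤ < a → 0ℤ < norm (a , b)
0<a⇒0<norm {b = b} 0<a = +-mono-<-≤ (square-mono-< ≤-refl 0<a) (square-nonNeg b)

infix 4 _≡_mod_
_≡_mod_ : ℤ[i] → ℤ[i] → ℤ[i] → Set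
z ≡ w mod β = ∃[ q ] z ≡ w ⊕ (q ⊗ β)

mod-trans : ∀ {z w v β} → z ≡ w mod β → w ≡ v mod β → z ≡ v mod β
mod-trans {v = v₁ , v₂} {β = a , b} ((p₁ , p₂) , refl) ((q₁ , q₂) , refl) =
  (q₁ , q₂) ⊕ (p₁ , p₂) ,
  cong₂ _,_ (collect₁ v₁ p₁ p₂ q₁ q₂ a b) (collect₂ v₂ p₁ p₂ q₁ q₂ a b)
  where
  collect₁ : ∀ v₁ p₁ p₂ q₁ q₂ a b →
    v₁ + (q₁ * a - q₂ * b) + (p₁ * a - p₂ * b) ≡ v₁ + ((q₁ + p₁) * a - (q₂ + p₂) * b)
  collect₁ = solve-∀
  collect₂ : ∀ v₂ p₁ p₂ q₁ q₂ a b →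
    v₂ + (q₁ * b + q₂ * a) + (p₁ * b + p₂ * a) ≡ v₂ + ((q₁ + p₁) * b + (q₂ + p₂) * a)
  collect₂ = solve-∀

mod-⊗ˡ : ∀ u {z w β} → z ≡ w mod β → u ⊗ z ≡ u ⊗ w mod β
mod-⊗ˡ (u₁ , u₂) {w = w₁ , w₂} {β = a , b} ((q₁ , q₂) , refl) =
  (u₁ , u₂) ⊗ (q₁ , q₂) ,
  cong₂ _,_ (distrib₁ u₁ u₂ w₁ w₂ q₁ q₂ a b) (distrib₂ u₁ u₂ w₁ w₂ q₁ q₂ a b)
  where
  distrib₁ : ∀ u₁ u₂ w₁ w₂ q₁ q₂ a b →
    u₁ * (w₁ + (q₁ * a - q₂ * b)) - u₂ * (w₂ + (q₁ * b + q₂ * a))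
      ≡ u₁ * w₁ - u₂ * w₂ + ((u₁ * q₁ - u₂ * q₂) * a - (u₁ * q₂ + u₂ * q₁) * b)
  distrib₁ = solve-∀
  distrib₂ : ∀ u₁ u₂ w₁ w₂ q₁ q₂ a b →
    u₁ * (w₂ + (q₁ * b + q₂ * a)) + u₂ * (w₁ + (q₁ * a - q₂ * b))
      ≡ u₁ * w₂ + u₂ * w₁ + ((u₁ * q₁ - u₂ * q₂) * b + (u₁ * q₂ + u₂ * q₁) * a)
  distrib₂ = solve-∀

⊖-⊕-cancel : ∀ z w → z ≡ (z ⊕ -ᵢ w) ⊕ w
⊖-⊕-cancel (x , y) (c , d) = cong₂ _,_ (cancel x c) (cancel y d)
  where
  cancel : ∀ x c → x ≡ x + - c + c
  cancel = solve-∀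

remainder-⊗-conj : ∀ x y a b k₁ k₂ →
  ((x , y) ⊕ -ᵢ ((k₁ , k₂) ⊗ (a , b))) ⊗ conj (a , b)
    ≡ (x * a - y * - b - k₁ * (a * a + b * b) , x * - b + y * a - k₂ * (a * a + b * b))
remainder-⊗-conj x y a b k₁ k₂ = cong₂ _,_ (expand₁ x y a b k₁ k₂) (expand₂ x y a b k₁ k₂)
  where
  expand₁ : ∀ x y a b k₁ k₂ →
    (x + - (k₁ * a - k₂ * b)) * a - (y + - (k₁ * b + k₂ * a)) * - b
      ≡ x * a - y * - b - k₁ * (a * a + b * b)
  expand₁ = solve-∀
  expand₂ : ∀ x y a b k₁ k₂ →
    (x + - (k₁ * a - k₂ * b)) * - b + (y + - (k₁ * b + k₂ * a)) * a
      ≡ x * - b + y * a - k₂ * (a * a + b * b)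
  expand₂ = solve-∀

euclidean-division : ∀ β → 0ℤ < norm β → ∀ z →
                     ∃[ r ] (z ≡ r mod β × norm r + norm r ≤ norm β)
-- The quotient is taken apart in a helper rather than by 'with', and the implicit arguments of
-- centred-sum-of-squares are given: otherwise Agda normalises the integer arithmetic in the
-- goal, unfolding _*_ into sign/absolute-value terms of exponential size.
euclidean-division β@(a , b) 0<n z@(x , y) =
  divide (centred-residue (x * a - y * - b) (norm β) 0<n)
         (centred-residue (x * - b + y * a) (norm β) 0<n)
  where
  divide : ∃[ k₁ ] Centred (norm β) (x * a - y * - b - k₁ * norm β) →
           ∃[ k₂ ] Centred (norm β) (x * - b + y * a - k₂ * norm β) →
           ∃[ r ] (z ≡ r mod β × norm r + norm r ≤ norm β)
  divide (k₁ , centred₁) (k₂ , centred₂) =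
    r , ((k₁ , k₂) , ⊖-⊕-cancel z ((k₁ , k₂) ⊗ β)) ,
    centred-sum-of-squares {norm β} {x * a - y * - b - k₁ * norm β}
                           {x * - b + y * a - k₂ * norm β} {norm r} 0<n centred₁ centred₂
      (trans (cong norm (sym (remainder-⊗-conj x y a b k₁ k₂))) (norm-⊗-conj r β))
    where
    r : ℤ[i]
    r = z ⊕ -ᵢ ((k₁ , k₂) ⊗ β)

OpenSquare : ℤ → Subset
OpenSquare a (x , y) = (- a < x × x < a) × (- a < y × y < a)

half-norm⇒OpenSquare : ∀ {a b r} → 0ℤ ≤ b → b < a → norm r + norm r ≤ norm (a , b) →
                       OpenSquare a r
half-norm⇒OpenSquare {a} {b} {x , y} 0≤b b<a small =
  square-<⇒bounded 0≤a (≤-<-trans (i≤i+j (x * x) (y * y) ⦃ nonNegative (square-nonNeg y) ⦄)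
                                  norm<a²) ,
  square-<⇒bounded 0≤a (≤-<-trans (i≤j+i (y * y) (x * x) ⦃ nonNegative (square-nonNeg x) ⦄)
                                  norm<a²)
  where
  0≤a : 0ℤ ≤ a
  0≤a = <⇒≤ (≤-<-trans 0≤b b<a)
  norm<a² : norm (x , y) < a * a
  norm<a² = double-<⇒< (begin-strict
    norm (x , y) + norm (x , y) ≤⟨ small ⟩
    a * a + b * b               <⟨ +-monoʳ-< (a * a) (square-mono-< 0≤b b<a) ⟩
    a * a + a * a               ∎)
    where open ≤-Reasoning

data IsUnit : ℤ[i] → Set where
  one       : IsUnit oneᵢ
  minus-one : IsUnit minusOneᵢ
  i         : IsUnit iᵢ
  minus-i   : IsUnit minusIᵢ

UnitClosed-⊗ : ∀ {M u m} → UnitClosed M → IsUnit u → M m → M (u ⊗ m)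
UnitClosed-⊗ closed one       m∈M = proj₁ (closed _ m∈M)
UnitClosed-⊗ closed minus-one m∈M = proj₁ (proj₂ (closed _ m∈M))
UnitClosed-⊗ closed i         m∈M = proj₁ (proj₂ (proj₂ (closed _ m∈M)))
UnitClosed-⊗ closed minus-i   m∈M = proj₂ (proj₂ (proj₂ (closed _ m∈M)))

negate-into-range : ∀ {a x} → ¬ (0ℤ ≤ x) → - a < x → 0ℤ ≤ - x × - x < a
negate-into-range {a} x≱0 -a<x =
  <⇒≤ (neg-mono-< (≰⇒> x≱0)) , subst (_ <_) (neg-involutive a) (neg-mono-< -a<x)

unit-rotations : ∀ x y →
  (x , y) ≡ oneᵢ ⊗ (x , y) × (x , y) ≡ iᵢ ⊗ (y , - x) ×
  (x , y) ≡ minusOneᵢ ⊗ (- x , - y) × (x , y) ≡ minusIᵢ ⊗ (- y , x)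
unit-rotations x y =
  cong₂ _,_ (one₁ x y) (one₂ x y) , cong₂ _,_ (i₁ x y) (i₂ x y) ,
  cong₂ _,_ (minus-one₁ x y) (minus-one₂ x y) , cong₂ _,_ (minus-i₁ x y) (minus-i₂ x y)
  where
  one₁ : ∀ x y → x ≡ 1ℤ * x - 0ℤ * y
  one₁ = solve-∀
  one₂ : ∀ x y → y ≡ 1ℤ * y + 0ℤ * x
  one₂ = solve-∀
  i₁ : ∀ x y → x ≡ 0ℤ * y - 1ℤ * - x
  i₁ = solve-∀
  i₂ : ∀ x y → y ≡ 0ℤ * - x + 1ℤ * y
  i₂ = solve-∀
  minus-one₁ : ∀ x y → x ≡ - 1ℤ * - x - 0ℤ * - y
  minus-one₁ = solve-∀
  minus-one₂ : ∀ x y → y ≡ - 1ℤ * - y + 0ℤ * - x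
  minus-one₂ = solve-∀
  minus-i₁ : ∀ x y → x ≡ 0ℤ * - y - - 1ℤ * x
  minus-i₁ = solve-∀
  minus-i₂ : ∀ x y → y ≡ 0ℤ * x + - 1ℤ * - y
  minus-i₂ = solve-∀

RotatedBox : ℤ → Subset
RotatedBox a r = ∃[ u ] (IsUnit u × ∃[ s ] (Box a s × r ≡ u ⊗ s))

OpenSquare⇒RotatedBox : ∀ {a r} → OpenSquare a r → RotatedBox a r
OpenSquare⇒RotatedBox {a} {x , y} ((-a<x , x<a) , (-a<y , y<a)) with 0ℤ ≤? x | 0ℤ ≤? y
... | yes 0≤x | yes 0≤y = oneᵢ , one , (x , y) , ((0≤x , x<a) , (0≤y , y<a)) ,
  proj₁ (unit-rotations x y)
... | no x≱0  | yes 0≤y = iᵢ , i , (y , - x) , ((0≤y , y<a) , negate-into-range x≱0 -a<x) ,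
  proj₁ (proj₂ (unit-rotations x y))
... | no x≱0  | no y≱0  = minusOneᵢ , minus-one , (- x , - y) ,
  (negate-into-range x≱0 -a<x , negate-into-range y≱0 -a<y) ,
  proj₁ (proj₂ (proj₂ (unit-rotations x y)))
... | yes 0≤x | no y≱0  = minusIᵢ , minus-i , (- y , x) ,
  (negate-into-range y≱0 -a<y , (0≤x , x<a)) ,
  proj₂ (proj₂ (proj₂ (unit-rotations x y)))

RotatedBox-representative : ∀ {a b} → 0ℤ ≤ b → b < a → ∀ z →
                            ∃[ r ] (z ≡ r mod (a +ᵢ b) × RotatedBox a r)
RotatedBox-representative {a} {b} 0≤b b<a z =
  rotate (euclidean-division (a +ᵢ b) (0<a⇒0<norm {b = b} (≤-<-trans 0≤b b<a)) z)
  where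
  rotate : ∃[ r ] (z ≡ r mod (a +ᵢ b) × norm r + norm r ≤ norm (a +ᵢ b)) →
           ∃[ r ] (z ≡ r mod (a +ᵢ b) × RotatedBox a r)
  rotate (r , z≡r , small) =
    r , z≡r , OpenSquare⇒RotatedBox (half-norm⇒OpenSquare {a} {b} {r} 0≤b b<a small)

corollary2p9 : (a b : ℤ) → b < a → 0ℤ ≤ b →
    (M : Subset) → UnitClosed M →
    (∀ z → Box a z → Translates M (a +ᵢ b) z) →
    Surjects M (a +ᵢ b)
corollary2p9 a b b<a 0≤b M closed S⊆U z = represent (RotatedBox-representative 0≤b b<a z)
  where
  represent : ∃[ r ] (z ≡ r mod (a +ᵢ b) × RotatedBox a r) → ∃[ m ] (M m × z ≡ m mod (a +ᵢ b))
  represent (_ , z≡us , u , unit , s , s∈S , refl) = rotate-back (S⊆U s s∈S)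
    where
    rotate-back : Translates M (a +ᵢ b) s → ∃[ m ] (M m × z ≡ m mod (a +ᵢ b))
    rotate-back (m , q , m∈M , s≡m+qβ) =
      u ⊗ m , UnitClosed-⊗ closed unit m∈M ,
      mod-trans {v = u ⊗ m} z≡us (mod-⊗ˡ u {w = m} {β = a +ᵢ b} (q , s≡m+qβ))
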